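{- Every palindromic tree has a number of vertices divisible by $4$, and every antipalindromic tree has a number of vertices congruent to $2$ modulo $4$.
   Context: All graphs are finite, simple and undirected. For a graph $G$ on $n$ vertices with adjacency matrix $A_G$, its characteristic polynomial is $\chi_G(\lambda)=\det(\lambda I-A_G)=a_0\lambda^n+a_1\lambda^{n-1}+\dots+a_n$ (so $a_0=1$). $G$ is palindromic if $a_i=a_{n-i}$ for all $i=0,\dots,n$, and antipalindromic if $a_i=-a_{n-i}$ for all $i=0,\dots,n$. -}

module Defs where

open import Data.Nat using (ℕ; zero; suc; _∸_; _≤_; _<_)
open import Data.Integer as ℤ using (ℤ; 0ℤ; 1ℤ; -1ℤ)
open import Data.Bool using (Bool; true; false; if_then_else_)
open import Data.Fin using (Fin; zero; suc; punchIn; _≟_)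
open import Data.List using (List; []; _∷_; length)
open import Data.List.Relation.Unary.Unique.Propositional using (Unique)
open import Data.Product using (Σ; ∃; _×_)
open import Relation.Nullary using (¬_; does)
open import Relation.Binary.PropositionalEquality using (_≡_)

record Graph (n : ℕ) : Set where
  field
    adj       : Fin n → Fin n → Bool
    adj-sym   : ∀ i j → adj i j ≡ adj j i
    adj-irrefl : ∀ i → adj i i ≡ false
open Graph public

Adj : ∀ {n} → Graph n → Fin n → Fin n → Set
Adj G u v = adj G u v ≡ true

data Walk {n} (G : Graph n) : Fin n → Fin n → Set where
  [] : ∀ {u} → Walk G u u
  _∷_ : ∀ {u v w} → Adj G u v → Walk G v w → Walk G u w

Connected : ∀ {n} → Graph n → Set
Connected G = ∀ u v → Walk G u v

data Chain {n} (G : Graph n) : List (Fin n) → Set where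
  single : ∀ {u} → Chain G (u ∷ [])
  step   : ∀ {u v vs} → Adj G u v → Chain G (v ∷ vs) → Chain G (u ∷ v ∷ vs)

IsCycle : ∀ {n} → Graph n → List (Fin n) → Set
IsCycle G [] = Data.Empty.⊥ where import Data.Empty
IsCycle G (v₀ ∷ vs) =
  3 ≤ length (v₀ ∷ vs) × Unique (v₀ ∷ vs) × Chain G (v₀ ∷ vs) × Adj G (lastOr v₀ vs) v₀
  where
  lastOr : Fin _ → List (Fin _) → Fin _
  lastOr x [] = x
  lastOr x (y ∷ ys) = lastOr y ys

Acyclic : ∀ {n} → Graph n → Set
Acyclic G = ∀ cs → ¬ IsCycle G cs

IsTree : ∀ {n} → Graph n → Set
IsTree G = Connected G × Acyclic G

-- Polynomials over ℤ as coefficient lists, lowest degree first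

Poly : Set
Poly = List ℤ

infixl 6 _+ₚ_
infixl 7 _*ₚ_ _·ₚ_

_+ₚ_ : Poly → Poly → Poly
[] +ₚ q = q
(a ∷ p) +ₚ [] = a ∷ p
(a ∷ p) +ₚ (b ∷ q) = (a ℤ.+ b) ∷ (p +ₚ q)

_·ₚ_ : ℤ → Poly → Poly
c ·ₚ [] = []
c ·ₚ (a ∷ p) = (c ℤ.* a) ∷ (c ·ₚ p)

_*ₚ_ : Poly → Poly → Poly
[] *ₚ q = []
(a ∷ p) *ₚ q = (a ·ₚ q) +ₚ (0ℤ ∷ (p *ₚ q))

coeff : Poly → ℕ → ℤ
coeff [] k = 0ℤ
coeff (a ∷ p) zero = a
coeff (a ∷ p) (suc k) = coeff p k

det : ∀ n → (Fin n → Fin n → Poly) → Poly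
det zero M = 1ℤ ∷ []
det (suc n) M = sumCols 1ℤ (λ j → j)
  where
  minor : Fin (suc n) → Fin n → Fin n → Poly
  minor j r c = M (suc r) (punchIn j c)
  sumCols : ∀ {m} → ℤ → (Fin m → Fin (suc n)) → Poly
  sumCols {zero} s f = []
  sumCols {suc m} s f =
    (s ·ₚ (M zero (f zero) *ₚ det n (minor (f zero))))
      +ₚ sumCols (ℤ.- s) (λ k → f (suc k))

adjMatrix : ∀ {n} → Graph n → Fin n → Fin n → ℤ
adjMatrix G i j = if adj G i j then 1ℤ else 0ℤ

charMatrix : ∀ {n} → Graph n → Fin n → Fin n → Poly
charMatrix G i j =
  (if does (i ≟ j) then 0ℤ ∷ 1ℤ ∷ [] else []) +ₚ (ℤ.- adjMatrix G i j ∷ [])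

charPoly : ∀ {n} → Graph n → Poly
charPoly {n} G = det n (charMatrix G)

a : ∀ {n} → Graph n → ℕ → ℤ
a {n} G i = coeff (charPoly G) (n ∸ i)

Palindromic : ∀ {n} → Graph n → Set
Palindromic {n} G = ∀ i → i ≤ n → a G i ≡ a G (n ∸ i)

Antipalindromic : ∀ {n} → Graph n → Set
Antipalindromic {n} G = ∀ i → i ≤ n → a G i ≡ ℤ.- a G (n ∸ i)

-- χ_G(λ) = det(λI − A) has leading coefficient a₀ = 1 and constant term
-- aₙ = det(−A). For a forest, det(−A) is 0 or (−1)^m with n = 2m, because an
-- acyclic graph has a vertex of degree at most one. An isolated vertex gives
-- a zero row. For a leaf v with neighbour u, expanding along the row of v and
-- then the column of v leaves −det(−A) of the forest G − u − v; moving v and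
-- u to the front uses that det is invariant under a simultaneous permutation
-- of rows and columns, which rests on its antisymmetry in the first two rows.
-- So a palindromic tree has 1 = a₀ = aₙ = (−1)^(n/2), i.e. 4 ∣ n, and an
-- antipalindromic one has 1 = −aₙ, i.e. n ≡ 2 (mod 4).

module Submission where

open import Defs using (Graph; IsTree; Palindromic; Antipalindromic)

module Polynomials where

  open import Defs using (Poly; _+ₚ_; _·ₚ_; _*ₚ_; coeff)
  open import Data.Nat as ℕ using (ℕ; zero; suc; z≤n; s≤s)
  open import Data.Nat.Properties using (≤-trans; m≤n+m; m≤n⇒m≤1+n)
  open import Data.Integer using (0ℤ; _+_; _*_)
  open import Data.Integer.Properties using (+-identityˡ; +-identityʳ; *-zeroˡ; *-zeroʳ)
  open import Data.List using ([]; _∷_)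
  open import Function using (_∘_)
  open import Relation.Binary.PropositionalEquality

  coeff-+ₚ : ∀ p q k → coeff (p +ₚ q) k ≡ coeff p k + coeff q k
  coeff-+ₚ []      q       k       = sym (+-identityˡ _)
  coeff-+ₚ (x ∷ p) []      k       = sym (+-identityʳ _)
  coeff-+ₚ (x ∷ p) (y ∷ q) zero    = refl
  coeff-+ₚ (x ∷ p) (y ∷ q) (suc k) = coeff-+ₚ p q k

  coeff-·ₚ : ∀ c p k → coeff (c ·ₚ p) k ≡ c * coeff p k
  coeff-·ₚ c []      k       = sym (*-zeroʳ c)
  coeff-·ₚ c (x ∷ p) zero    = refl
  coeff-·ₚ c (x ∷ p) (suc k) = coeff-·ₚ c p k

  coeff-∷*ₚ-zero : ∀ x p q → coeff ((x ∷ p) *ₚ q) 0 ≡ x * coeff q 0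
  coeff-∷*ₚ-zero x p q = trans (coeff-+ₚ (x ·ₚ q) _ 0) (trans (+-identityʳ _) (coeff-·ₚ x q 0))

  coeff-∷*ₚ-suc : ∀ x p q k → coeff ((x ∷ p) *ₚ q) (suc k) ≡ x * coeff q (suc k) + coeff (p *ₚ q) k
  coeff-∷*ₚ-suc x p q k = trans (coeff-+ₚ (x ·ₚ q) _ (suc k)) (cong (_+ _) (coeff-·ₚ x q (suc k)))

  coeff₀-*ₚ : ∀ p q → coeff (p *ₚ q) 0 ≡ coeff p 0 * coeff q 0
  coeff₀-*ₚ []      q = refl
  coeff₀-*ₚ (x ∷ p) q = coeff-∷*ₚ-zero x p q

  Deg≤ : Poly → ℕ → Set
  Deg≤ p d = ∀ k → d ℕ.< k → coeff p k ≡ 0ℤ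

  Deg≤-+ₚ : ∀ p q {d} → Deg≤ p d → Deg≤ q d → Deg≤ (p +ₚ q) d
  Deg≤-+ₚ p q dp dq k d<k = trans (coeff-+ₚ p q k) (cong₂ _+_ (dp k d<k) (dq k d<k))

  Deg≤-·ₚ : ∀ c p {d} → Deg≤ p d → Deg≤ (c ·ₚ p) d
  Deg≤-·ₚ c p dp k d<k = trans (coeff-·ₚ c p k) (trans (cong (c *_) (dp k d<k)) (*-zeroʳ c))

  *ₚ-zeroˡ : ∀ p q → (∀ k → coeff p k ≡ 0ℤ) → ∀ k → coeff (p *ₚ q) k ≡ 0ℤ
  *ₚ-zeroˡ []      q p≡0 k       = refl
  *ₚ-zeroˡ (x ∷ p) q p≡0 zero    = trans (coeff-∷*ₚ-zero x p q)
    (trans (cong (_* coeff q 0) (p≡0 0)) (*-zeroˡ (coeff q 0)))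
  *ₚ-zeroˡ (x ∷ p) q p≡0 (suc k) = trans (coeff-∷*ₚ-suc x p q k)
    (cong₂ _+_ (trans (cong (_* coeff q (suc k)) (p≡0 0)) (*-zeroˡ (coeff q (suc k)))) (*ₚ-zeroˡ p q (p≡0 ∘ suc) k))

  Deg≤-*ₚ : ∀ p q {d e} → Deg≤ p d → Deg≤ q e → Deg≤ (p *ₚ q) (d ℕ.+ e)
  Deg≤-*ₚ []      q             dp dq k       _         = refl
  Deg≤-*ₚ (x ∷ p) q {zero}  {e} dp dq (suc k) (s≤s e≤k) = trans (coeff-∷*ₚ-suc x p q k)
    (cong₂ _+_ (trans (cong (x *_) (dq (suc k) (s≤s e≤k))) (*-zeroʳ x))
               (*ₚ-zeroˡ p q (λ j → dp (suc j) (s≤s z≤n)) k))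
  Deg≤-*ₚ (x ∷ p) q {suc d} {e} dp dq (suc k) (s≤s d+e<k) = trans (coeff-∷*ₚ-suc x p q k)
    (cong₂ _+_ (trans (cong (x *_) (dq (suc k) (≤-trans (s≤s (m≤n+m e d)) (m≤n⇒m≤1+n d+e<k)))) (*-zeroʳ x))
                              (Deg≤-*ₚ p q (λ j d<j → dp (suc j) (s≤s d<j)) dq k d+e<k))

  coeff-*ₚ-top : ∀ p q {d e} → Deg≤ p d → Deg≤ q e → coeff (p *ₚ q) (d ℕ.+ e) ≡ coeff p d * coeff q e
  coeff-*ₚ-top []      q {d} {e} dp dq = sym (*-zeroˡ (coeff q e))
  coeff-*ₚ-top (x ∷ p) q {zero} {zero} dp dq = coeff-∷*ₚ-zero x p q
  coeff-*ₚ-top (x ∷ p) q {zero} {suc e} dp dq = trans (coeff-∷*ₚ-suc x p q e)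
    (trans (cong (x * coeff q (suc e) +_) (*ₚ-zeroˡ p q (λ j → dp (suc j) (s≤s z≤n)) e)) (+-identityʳ _))
  coeff-*ₚ-top (x ∷ p) q {suc d} {e} dp dq = trans (coeff-∷*ₚ-suc x p q (d ℕ.+ e))
    (trans (cong₂ _+_ (trans (cong (x *_) (dq _ (s≤s (m≤n+m e d)))) (*-zeroʳ x))
                      (coeff-*ₚ-top p q (λ j d<j → dp (suc j) (s≤s d<j)) dq))
           (+-identityˡ _))

open Polynomials

module Determinants where

  open import Data.Nat using (ℕ; zero; suc)
  open import Data.Integer using (ℤ; 0ℤ; 1ℤ; -1ℤ; _+_; _*_; -_)
  open import Data.Integer.Properties
    using ( +-*-semiring; +-identityʳ; *-zeroˡ; *-zeroʳ; *-identityˡ; *-identityʳ; *-assoc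
          ; *-distribˡ-+; neg-distribˡ-*; -1*i≡-i)
  open import Data.Integer.Tactic.RingSolver using (solve-∀)
  open import Algebra.Properties.Semiring.Sum +-*-semiring
    using (sum; sum-syntax; sum-cong-≗; sum-replicate-zero; sum-remove; ∑-comm; *-distribˡ-sum; *-distribʳ-sum)
  open import Data.Fin using (Fin; zero; suc; punchIn; punchOut; _≟_)
  open import Data.Fin.Properties using (punchIn-injective; punchInᵢ≢i; punchIn-punchOut)
  open import Data.Vec.Functional using (Vector; _∷_; tail; removeAt)
  open import Data.Bool using (if_then_else_)
  open import Data.Product using (∃; _×_; _,_)
  open import Data.Empty using (⊥-elim)
  open import Function using (_∘_)
  open import Relation.Nullary using (does; yes; no)
  open import Relation.Nullary.Decidable using (dec-true; dec-false)
  open import Relation.Binary.PropositionalEquality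

  Matrix : ℕ → Set
  Matrix n = Vector (Vector ℤ n) n

  sign : ∀ {m} → Fin m → ℤ
  sign zero    = 1ℤ
  sign (suc k) = - sign k

  minor : ∀ {A : Set} {n} → Vector (Vector A (suc n)) (suc n) → Fin (suc n) → Vector (Vector A n) n
  minor M j r = removeAt (M (suc r)) j

  detℤ : ∀ n → Matrix n → ℤ
  detℤ zero    M = 1ℤ
  detℤ (suc n) M = ∑[ j < suc n ] (sign j * (M zero j * detℤ n (minor M j)))

  sum-zero : ∀ {m} (f : Vector ℤ m) → (∀ k → f k ≡ 0ℤ) → sum f ≡ 0ℤ
  sum-zero {m} f f≡0 = trans (sum-cong-≗ f≡0) (sum-replicate-zero m)

  sum-single : ∀ {m} (f : Vector ℤ (suc m)) c → (∀ k → k ≢ c → f k ≡ 0ℤ) → sum f ≡ f c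
  sum-single f c f≡0 = trans (sum-remove f)
    (trans (cong (f c +_) (sum-zero _ (λ k → f≡0 _ (punchInᵢ≢i c k)))) (+-identityʳ (f c)))

  sign-sq : ∀ {m} (k : Fin m) → sign k * sign k ≡ 1ℤ
  sign-sq zero    = refl
  sign-sq (suc k) = trans (neg*neg (sign k)) (sign-sq k)
    where
    neg*neg : ∀ x → (- x) * (- x) ≡ x * x
    neg*neg = solve-∀

  sign-sq-* : ∀ {m} (k : Fin m) x → sign k * (sign k * x) ≡ x
  sign-sq-* k x = trans (sym (*-assoc (sign k) (sign k) x)) (trans (cong (_* x) (sign-sq k)) (*-identityˡ x))

  detℤ-cong : ∀ n {M N : Matrix n} → (∀ i j → M i j ≡ N i j) → detℤ n M ≡ detℤ n N
  detℤ-cong zero    M≡N = refl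
  detℤ-cong (suc n) M≡N = sum-cong-≗ λ j →
    cong₂ (λ x y → sign j * (x * y)) (M≡N zero j) (detℤ-cong n (λ r c → M≡N (suc r) (punchIn j c)))

  detℤ-row-single : ∀ n (M : Matrix (suc n)) c → (∀ j → j ≢ c → M zero j ≡ 0ℤ) →
                    detℤ (suc n) M ≡ sign c * (M zero c * detℤ n (minor M c))
  detℤ-row-single n M c M₀≡0 = sum-single _ c λ j j≢c →
    trans (cong (λ x → sign j * (x * detℤ n (minor M j))) (M₀≡0 j j≢c))
          (trans (cong (sign j *_) (*-zeroˡ (detℤ n (minor M j)))) (*-zeroʳ (sign j)))

  detℤ-zero-row : ∀ n (M : Matrix (suc n)) → (∀ j → M zero j ≡ 0ℤ) → detℤ (suc n) M ≡ 0ℤ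
  detℤ-zero-row n M M₀≡0 = trans (detℤ-row-single n M zero (λ j _ → M₀≡0 j))
    (cong (λ x → 1ℤ * (x * detℤ n (minor M zero))) (M₀≡0 zero))

  private
    zero-factorˡ : ∀ s {x} y → x ≡ 0ℤ → s * (x * y) ≡ 0ℤ
    zero-factorˡ s y refl = *-zeroʳ s

    zero-factorʳ : ∀ s x {y} → y ≡ 0ℤ → s * (x * y) ≡ 0ℤ
    zero-factorʳ s x refl = trans (cong (s *_) (*-zeroʳ x)) (*-zeroʳ s)

  detℤ-zero-column : ∀ n (M : Matrix n) c → (∀ i → M i c ≡ 0ℤ) → detℤ n M ≡ 0ℤ
  detℤ-zero-column (suc n) M c M·c≡0 = sum-zero _ term
    where
    term : ∀ j → sign j * (M zero j * detℤ n (minor M j)) ≡ 0ℤ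
    term j with j ≟ c
    ... | yes refl = zero-factorˡ (sign j) _ (M·c≡0 zero)
    ... | no j≢c   = zero-factorʳ (sign j) (M zero j) (detℤ-zero-column n (minor M j) (punchOut j≢c)
                       (λ r → trans (cong (M (suc r)) (punchIn-punchOut j≢c)) (M·c≡0 (suc r))))

  detℤ-column-single : ∀ n (M : Matrix (suc n)) → (∀ r → M (suc r) zero ≡ 0ℤ) →
                       detℤ (suc n) M ≡ M zero zero * detℤ n (minor M zero)
  detℤ-column-single n M M·₀≡0 =
    trans (cong (1ℤ * (M zero zero * detℤ n (minor M zero)) +_) (sum-zero _ λ k →
             zero-factorʳ (sign (suc k)) (M zero (suc k))
               (detℤ-zero-column n (minor M (suc k)) (punchOut {i = suc k} {j = zero} λ ())
                 (λ r → trans (cong (M (suc r)) (punchIn-punchOut {i = suc k} λ ())) (M·₀≡0 r)))))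
    (trans (+-identityʳ _) (*-identityˡ _))

  detℤ-leaf : ∀ n (N : Matrix (suc (suc n))) →
              (∀ j → j ≢ suc zero → N zero j ≡ 0ℤ) → (∀ r → N (suc (suc r)) zero ≡ 0ℤ) →
              detℤ (suc (suc n)) N
                ≡ - (N zero (suc zero) * (N (suc zero) zero * detℤ n (λ r c → N (suc (suc r)) (suc (suc c)))))
  detℤ-leaf n N N₀≡0 N·₀≡0 =
    trans (detℤ-row-single (suc n) N (suc zero) N₀≡0)
    (trans (-1*i≡-i _)
           (cong (λ d → - (N zero (suc zero) * d)) (detℤ-column-single n (minor N (suc zero)) N·₀≡0)))

  unit : ∀ {m} → Fin m → Vector ℤ m
  unit b j = if does (b ≟ j) then 1ℤ else 0ℤ

  unit-diag : ∀ {m} (b : Fin m) → unit b b ≡ 1ℤ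
  unit-diag b = cong (if_then 1ℤ else 0ℤ) (dec-true (b ≟ b) refl)

  unit-off : ∀ {m} {b j : Fin m} → b ≢ j → unit b j ≡ 0ℤ
  unit-off {b = b} {j} b≢j = cong (if_then 1ℤ else 0ℤ) (dec-false (b ≟ j) b≢j)

  unit-punchIn : ∀ {m} (a : Fin (suc m)) b j → unit (punchIn a b) (punchIn a j) ≡ unit b j
  unit-punchIn a b j with b ≟ j
  ... | yes refl = unit-diag (punchIn a b)
  ... | no b≢j   = unit-off (b≢j ∘ punchIn-injective a b j)

  sum-unit : ∀ {m} (y : Vector ℤ m) j → y j ≡ ∑[ b < m ] (y b * unit b j)
  sum-unit {suc m} y j = sym (trans (sum-single _ j (λ b b≢j → trans (cong (y b *_) (unit-off b≢j)) (*-zeroʳ (y b))))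
                                    (trans (cong (y j *_) (unit-diag j)) (*-identityʳ (y j))))

  detℤ-linear : ∀ n {p} (M : Matrix (suc n)) (y : Vector ℤ p) (U : Vector (Vector ℤ (suc n)) p) →
                (∀ j → M zero j ≡ ∑[ b < p ] (y b * U b j)) →
                detℤ (suc n) M ≡ ∑[ b < p ] (y b * detℤ (suc n) (U b ∷ tail M))
  detℤ-linear n {p} M y U M₀≡∑ = begin
    ∑[ j < suc n ] (sign j * (M zero j * C j))
      ≡⟨ sum-cong-≗ (λ j → cong (λ x → sign j * (x * C j)) (M₀≡∑ j)) ⟩
    ∑[ j < suc n ] (sign j * ((∑[ b < p ] (y b * U b j)) * C j))
      ≡⟨ sum-cong-≗ (λ j → trans (cong (sign j *_) (*-distribʳ-sum (C j) (λ b → y b * U b j)))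
                                 (*-distribˡ-sum (sign j) (λ b → y b * U b j * C j))) ⟩
    ∑[ j < suc n ] ∑[ b < p ] (sign j * (y b * U b j * C j))
      ≡⟨ ∑-comm (λ j b → sign j * (y b * U b j * C j)) ⟩
    ∑[ b < p ] ∑[ j < suc n ] (sign j * (y b * U b j * C j))
      ≡⟨ sum-cong-≗ (λ b → trans (sum-cong-≗ (λ j → regroup (sign j) (y b) (U b j) (C j)))
                                 (sym (*-distribˡ-sum (y b) (λ j → sign j * (U b j * C j))))) ⟩
    ∑[ b < p ] (y b * detℤ (suc n) (U b ∷ tail M)) ∎
    where
    open ≡-Reasoning
    C : Fin (suc n) → ℤ
    C j = detℤ n (minor M j)
    regroup : ∀ s y u c → s * (y * u * c) ≡ y * (s * (u * c))
    regroup = solve-∀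

  -- ± the minor of the rows R with columns a and b deleted (0 if a = b).
  pairCofactor : ∀ {n} → Vector (Vector ℤ (suc (suc n))) n → Fin (suc (suc n)) → Fin (suc (suc n)) → ℤ
  pairCofactor {n} R a b = sign a * detℤ (suc n) (removeAt (unit b) a ∷ λ r → removeAt (R r) a)

  detℤ-expand₂ : ∀ n x y (R : Vector (Vector ℤ (suc (suc n))) n) →
                 detℤ (suc (suc n)) (x ∷ y ∷ R)
                   ≡ ∑[ a < suc (suc n) ] ∑[ b < suc (suc n) ] (x a * (y b * pairCofactor R a b))
  detℤ-expand₂ n x y R = sum-cong-≗ λ a → begin
    sign a * (x a * detℤ (suc n) (minor (x ∷ y ∷ R) a))
      ≡⟨ cong (λ d → sign a * (x a * d))
              (detℤ-linear n (minor (x ∷ y ∷ R) a) y (λ b → removeAt (unit b) a) (sum-unit y ∘ punchIn a)) ⟩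
    sign a * (x a * ∑[ b < suc (suc n) ] (y b * D a b))
      ≡⟨ trans (cong (sign a *_) (*-distribˡ-sum (x a) (λ b → y b * D a b)))
               (*-distribˡ-sum (sign a) (λ b → x a * (y b * D a b))) ⟩
    ∑[ b < suc (suc n) ] (sign a * (x a * (y b * D a b)))
      ≡⟨ sum-cong-≗ (λ b → regroup (sign a) (x a) (y b) (D a b)) ⟩
    ∑[ b < suc (suc n) ] (x a * (y b * pairCofactor R a b)) ∎
    where
    open ≡-Reasoning
    D : Fin (suc (suc n)) → Fin (suc (suc n)) → ℤ
    D a b = detℤ (suc n) (removeAt (unit b) a ∷ λ r → removeAt (R r) a)
    regroup : ∀ s x y d → s * (x * (y * d)) ≡ x * (y * (s * d))
    regroup = solve-∀

  -- Deleting column a and then column b′ deletes the same two columns as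
  -- deleting b = punchIn a b′ and then a′; the two orders differ by a
  -- transposition, whence the signs.
  punchIn-exchange : ∀ {n} (a : Fin (suc (suc n))) (b′ : Fin (suc n)) →
    ∃ λ a′ → punchIn (punchIn a b′) a′ ≡ a
           × (∀ c → punchIn a (punchIn b′ c) ≡ punchIn (punchIn a b′) (punchIn a′ c))
           × sign (punchIn a b′) * sign a′ ≡ - (sign a * sign b′)
           × - sign b′ * sign a′ ≡ sign a * sign (punchIn a b′)
  punchIn-exchange zero b′ = zero , refl , (λ c → refl) , solve₁ (sign b′) , solve₂ (sign b′)
    where
    solve₁ : ∀ x → (- x) * 1ℤ ≡ - (1ℤ * x)
    solve₁ = solve-∀
    solve₂ : ∀ x → - x * 1ℤ ≡ 1ℤ * (- x)
    solve₂ = solve-∀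
  punchIn-exchange (suc a) zero = a , refl , (λ c → refl) , solve₁ (sign a) , solve₂ (sign a)
    where
    solve₁ : ∀ x → 1ℤ * x ≡ - ((- x) * 1ℤ)
    solve₁ = solve-∀
    solve₂ : ∀ x → - 1ℤ * x ≡ (- x) * 1ℤ
    solve₂ = solve-∀
  punchIn-exchange {suc n} (suc a) (suc b′) with punchIn-exchange a b′
  ... | a′ , a≡ , columns≡ , signs≡ , signs≡′ =
    suc a′ , cong suc a≡ , (λ { zero → refl ; (suc c) → cong suc (columns≡ c) }) ,
    trans (neg*neg (sign (punchIn a b′)) (sign a′)) (trans signs≡ (cong -_ (sym (neg*neg (sign a) (sign b′))))) ,
    trans (neg*neg (- sign b′) (sign a′)) (trans signs≡′ (sym (neg*neg (sign a) (sign (punchIn a b′)))))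
    where
    neg*neg : ∀ x y → (- x) * (- y) ≡ x * y
    neg*neg = solve-∀

  pairCofactor-diag : ∀ {n} (R : Vector (Vector ℤ (suc (suc n))) n) a → pairCofactor R a a ≡ 0ℤ
  pairCofactor-diag {n} R a = trans
    (cong (sign a *_) (detℤ-zero-row n (removeAt (unit a) a ∷ λ r → removeAt (R r) a) λ j → unit-off (punchInᵢ≢i a j ∘ sym)))
    (*-zeroʳ (sign a))

  pairCofactor-punchIn : ∀ {n} (R : Vector (Vector ℤ (suc (suc n))) n) a b′ →
    pairCofactor R a (punchIn a b′) ≡ sign a * (sign b′ * detℤ n (λ r c → R r (punchIn a (punchIn b′ c))))
  pairCofactor-punchIn {n} R a b′ = cong (sign a *_) (trans
    (detℤ-cong (suc n) {removeAt (unit (punchIn a b′)) a ∷ λ r → removeAt (R r) a} {unit b′ ∷ λ r → removeAt (R r) a}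
       λ { zero j → unit-punchIn a b′ j ; (suc r) j → refl })
    (trans (detℤ-row-single n (unit b′ ∷ λ r → removeAt (R r) a) b′ (λ j j≢b′ → unit-off (j≢b′ ∘ sym)))
           (trans (cong (λ x → sign b′ * (x * d)) (unit-diag b′)) (cong (sign b′ *_) (*-identityˡ d)))))
    where
    d = detℤ n (λ r c → R r (punchIn a (punchIn b′ c)))

  pairCofactor-antisym : ∀ {n} (R : Vector (Vector ℤ (suc (suc n))) n) a b → pairCofactor R a b ≡ - pairCofactor R b a
  pairCofactor-antisym R a b with a ≟ b
  ... | yes refl = trans (pairCofactor-diag R a) (cong -_ (sym (pairCofactor-diag R a)))
  ... | no a≢b   = subst (λ b → pairCofactor R a b ≡ - pairCofactor R b a) (punchIn-punchOut a≢b)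
                         (antisym-punchIn (punchOut a≢b))
    where
    flip-sign : ∀ x y z w d → z * w ≡ - (x * y) → x * (y * d) ≡ - (z * (w * d))
    flip-sign x y z w d zw≡ = trans (solve₁ x y d) (trans (cong (λ t → - (t * d)) (sym zw≡)) (solve₂ z w d))
      where
      solve₁ : ∀ x y d → x * (y * d) ≡ - ((- (x * y)) * d)
      solve₁ = solve-∀
      solve₂ : ∀ z w d → - ((z * w) * d) ≡ - (z * (w * d))
      solve₂ = solve-∀
    antisym-punchIn : ∀ b′ → pairCofactor R a (punchIn a b′) ≡ - pairCofactor R (punchIn a b′) a
    antisym-punchIn b′ with punchIn-exchange a b′
    ... | a′ , a≡ , columns≡ , signs≡ , _ = begin
      pairCofactor R a (punchIn a b′)
        ≡⟨ pairCofactor-punchIn R a b′ ⟩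
      sign a * (sign b′ * detℤ _ (λ r c → R r (punchIn a (punchIn b′ c))))
        ≡⟨ cong (λ d → sign a * (sign b′ * d)) (detℤ-cong _ (λ r c → cong (R r) (columns≡ c))) ⟩
      sign a * (sign b′ * detℤ _ (λ r c → R r (punchIn (punchIn a b′) (punchIn a′ c))))
        ≡⟨ flip-sign (sign a) (sign b′) (sign (punchIn a b′)) (sign a′) _ signs≡ ⟩
      - (sign (punchIn a b′) * (sign a′ * detℤ _ (λ r c → R r (punchIn (punchIn a b′) (punchIn a′ c)))))
        ≡⟨ cong -_ (sym (pairCofactor-punchIn R (punchIn a b′) a′)) ⟩
      - pairCofactor R (punchIn a b′) (punchIn (punchIn a b′) a′)
        ≡⟨ cong (λ x → - pairCofactor R (punchIn a b′) x) a≡ ⟩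
      - pairCofactor R (punchIn a b′) a ∎
      where open ≡-Reasoning

  detℤ-swap : ∀ n x y (R : Vector (Vector ℤ (suc (suc n))) n) →
              detℤ (suc (suc n)) (y ∷ x ∷ R) ≡ - detℤ (suc (suc n)) (x ∷ y ∷ R)
  detℤ-swap n x y R = begin
    detℤ _ (y ∷ x ∷ R)
      ≡⟨ detℤ-expand₂ n y x R ⟩
    ∑[ a < suc (suc n) ] ∑[ b < suc (suc n) ] (y a * (x b * pairCofactor R a b))
      ≡⟨ ∑-comm (λ a b → y a * (x b * pairCofactor R a b)) ⟩
    ∑[ b < suc (suc n) ] ∑[ a < suc (suc n) ] (y a * (x b * pairCofactor R a b))
      ≡⟨ sum-cong-≗ (λ b → sum-cong-≗ λ a → trans (cong (λ k → y a * (x b * k)) (pairCofactor-antisym R a b))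
                                                  (regroup (y a) (x b) (pairCofactor R b a))) ⟩
    ∑[ b < suc (suc n) ] ∑[ a < suc (suc n) ] (-1ℤ * (x b * (y a * pairCofactor R b a)))
      ≡⟨ sum-cong-≗ (λ b → sym (*-distribˡ-sum -1ℤ (λ a → x b * (y a * pairCofactor R b a)))) ⟩
    ∑[ b < suc (suc n) ] (-1ℤ * ∑[ a < suc (suc n) ] (x b * (y a * pairCofactor R b a)))
      ≡⟨ sym (*-distribˡ-sum -1ℤ (λ b → ∑[ a < suc (suc n) ] (x b * (y a * pairCofactor R b a)))) ⟩
    -1ℤ * ∑[ b < suc (suc n) ] ∑[ a < suc (suc n) ] (x b * (y a * pairCofactor R b a))
      ≡⟨ -1*i≡-i _ ⟩
    - ∑[ b < suc (suc n) ] ∑[ a < suc (suc n) ] (x b * (y a * pairCofactor R b a))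
      ≡⟨ cong -_ (sym (detℤ-expand₂ n x y R)) ⟩
    - detℤ _ (x ∷ y ∷ R) ∎
    where
    open ≡-Reasoning
    regroup : ∀ y x k → y * (x * (- k)) ≡ -1ℤ * (x * (y * k))
    regroup = solve-∀

  toFront : ∀ {n} → Fin (suc n) → Fin (suc n) → Fin (suc n)
  toFront v = v ∷ punchIn v

  toFront-injective : ∀ {n} (v : Fin (suc n)) {i j} → toFront v i ≡ toFront v j → i ≡ j
  toFront-injective v {zero}  {zero}  _ = refl
  toFront-injective v {zero}  {suc j} e = ⊥-elim (punchInᵢ≢i v j (sym e))
  toFront-injective v {suc i} {zero}  e = ⊥-elim (punchInᵢ≢i v i e)
  toFront-injective v {suc i} {suc j} e = cong suc (punchIn-injective v i j e)

  toFront-zero : ∀ {n} (i : Fin (suc n)) → toFront zero i ≡ i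
  toFront-zero zero    = refl
  toFront-zero (suc i) = refl

  detℤ-toFront-rows : ∀ n (M : Matrix (suc n)) v → detℤ (suc n) (M ∘ toFront v) ≡ sign v * detℤ (suc n) M
  detℤ-toFront-rows n M zero =
    trans (detℤ-cong (suc n) (λ i j → cong (λ i → M i j) (toFront-zero i))) (sym (*-identityˡ _))
  detℤ-toFront-rows (suc n) M (suc w) = begin
    detℤ _ (M ∘ toFront (suc w))
      ≡⟨ detℤ-cong (suc (suc n)) {M ∘ toFront (suc w)} {M (suc w) ∷ M zero ∷ R}
           (λ { zero j → refl ; (suc zero) j → refl ; (suc (suc r)) j → refl }) ⟩
    detℤ _ (M (suc w) ∷ M zero ∷ R)
      ≡⟨ detℤ-swap n (M zero) (M (suc w)) R ⟩
    - detℤ _ (M zero ∷ M (suc w) ∷ R)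
      ≡⟨ cong -_ (detℤ-cong (suc (suc n)) {M zero ∷ M (suc w) ∷ R} {M zero ∷ tail M ∘ toFront w}
                    (λ { zero j → refl ; (suc zero) j → refl ; (suc (suc r)) j → refl })) ⟩
    - detℤ _ (M zero ∷ tail M ∘ toFront w)
      ≡⟨ cong -_ (sum-cong-≗ λ j → cong (λ d → sign j * (M zero j * d)) (detℤ-toFront-rows n (minor M j) w)) ⟩
    - ∑[ j < suc (suc n) ] (sign j * (M zero j * (sign w * detℤ _ (minor M j))))
      ≡⟨ cong -_ (trans (sum-cong-≗ (λ j → regroup (sign j) (M zero j) (sign w) (detℤ _ (minor M j))))
                        (sym (*-distribˡ-sum (sign w) (λ j → sign j * (M zero j * detℤ (suc n) (minor M j)))))) ⟩
    - (sign w * detℤ _ M)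
      ≡⟨ neg-distribˡ-* (sign w) _ ⟩
    sign (suc w) * detℤ _ M ∎
    where
    open ≡-Reasoning
    R = tail M ∘ punchIn w
    regroup : ∀ s m t d → s * (m * (t * d)) ≡ t * (s * (m * d))
    regroup = solve-∀

  detℤ-toFront-columns : ∀ n (M : Matrix (suc n)) v →
                         detℤ (suc n) (λ i → M i ∘ toFront v) ≡ sign v * detℤ (suc n) M
  detℤ-toFront-columns zero    M zero = sym (*-identityˡ _)
  detℤ-toFront-columns (suc n) M v = begin
    1ℤ * (M zero v * detℤ (suc n) (minor M v))
      + ∑[ k < suc n ] (sign (suc k) * (M zero (punchIn v k) * detℤ (suc n) (minor (λ i → M i ∘ toFront v) (suc k))))
      ≡⟨ cong₂ _+_ (trans (*-identityˡ _) (sym (sign-sq-* v (M zero v * detℤ (suc n) (minor M v)))))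
                   (sum-cong-≗ moved-column) ⟩
    sign v * T v + ∑[ k < suc n ] (sign v * T (punchIn v k))
      ≡⟨ cong (sign v * T v +_) (sym (*-distribˡ-sum (sign v) (T ∘ punchIn v))) ⟩
    sign v * T v + sign v * ∑[ k < suc n ] T (punchIn v k)
      ≡⟨ sym (*-distribˡ-+ (sign v) _ _) ⟩
    sign v * (T v + ∑[ k < suc n ] T (punchIn v k))
      ≡⟨ cong (sign v *_) (sym (sum-remove {i = v} T)) ⟩
    sign v * detℤ (suc (suc n)) M ∎
    where
    open ≡-Reasoning
    T : Fin (suc (suc n)) → ℤ
    T j = sign j * (M zero j * detℤ (suc n) (minor M j))
    moved-column : ∀ k → sign (suc k) * (M zero (punchIn v k) * detℤ (suc n) (minor (λ i → M i ∘ toFront v) (suc k)))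
                         ≡ sign v * T (punchIn v k)
    moved-column k with punchIn-exchange v k
    ... | a′ , a≡ , columns≡ , _ , signs≡ = begin
      sign (suc k) * (m * detℤ (suc n) (minor (λ i → M i ∘ toFront v) (suc k)))
        ≡⟨ cong (λ d → sign (suc k) * (m * d))
             (detℤ-cong (suc n) {minor (λ i → M i ∘ toFront v) (suc k)} {λ r → minor M B r ∘ toFront a′} λ r →
             λ { zero → cong (M (suc r)) (sym a≡) ; (suc c) → cong (M (suc r)) (columns≡ c) }) ⟩
      sign (suc k) * (m * detℤ (suc n) (λ r → minor M B r ∘ toFront a′))
        ≡⟨ cong (λ d → sign (suc k) * (m * d)) (detℤ-toFront-columns n (minor M B) a′) ⟩
      (- sign k) * (m * (sign a′ * D))
        ≡⟨ regroup (sign k) (sign a′) m D ⟩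
      (- sign k * sign a′) * (m * D)
        ≡⟨ cong (_* (m * D)) signs≡ ⟩
      (sign v * sign B) * (m * D)
        ≡⟨ *-assoc (sign v) (sign B) (m * D) ⟩
      sign v * T B ∎
      where
      B = punchIn v k
      m = M zero B
      D = detℤ (suc n) (minor M B)
      regroup : ∀ s t m d → (- s) * (m * (t * d)) ≡ (- s * t) * (m * d)
      regroup = solve-∀

  detℤ-toFront : ∀ n (M : Matrix (suc n)) v → detℤ (suc n) (λ i j → M (toFront v i) (toFront v j)) ≡ detℤ (suc n) M
  detℤ-toFront n M v = begin
    detℤ (suc n) ((λ i → M i ∘ toFront v) ∘ toFront v)   ≡⟨ detℤ-toFront-rows n (λ i → M i ∘ toFront v) v ⟩
    sign v * detℤ (suc n) (λ i → M i ∘ toFront v)       ≡⟨ cong (sign v *_) (detℤ-toFront-columns n M v) ⟩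
    sign v * (sign v * detℤ (suc n) M)                  ≡⟨ sign-sq-* v (detℤ (suc n) M) ⟩
    detℤ (suc n) M                                      ∎
    where open ≡-Reasoning

open Determinants

module CharacteristicPolynomial where

  open import Defs
  open import Data.Nat as ℕ using (ℕ; zero; suc; s≤s)
  open import Data.Nat.Properties using (n<1+n; n∸n≡0)
  open import Data.Integer using (ℤ; 0ℤ; 1ℤ; -1ℤ; _+_; _*_; -_)
  open import Data.Integer.Properties using (+-*-semiring; *-zeroʳ; *-identityˡ; +-identityˡ)
  open import Data.Integer.Tactic.RingSolver using (solve-∀)
  open import Algebra.Properties.Semiring.Sum +-*-semiring using (sum-syntax; sum-cong-≗; *-distribˡ-sum)
  open import Data.Fin using (Fin; zero; suc; punchIn; _≟_)
  open import Data.Fin.Properties using (suc-injective)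
  open import Data.List using ([]; _∷_)
  open import Data.Bool using (true; false; if_then_else_)
  open import Data.Unit using (⊤; tt)
  open import Function using (_∘_)
  open import Relation.Nullary using (does)
  open import Relation.Nullary.Decidable using (dec-true; dec-false)
  open import Relation.Binary.PropositionalEquality

  -- `det` is defined through a local helper, which cannot be named; the
  -- meta-variable `cofactorSum` is solved to it by unifying against an unfolding
  -- of `det` in which the helper is applied to variables only.
  mutual
    cofactorSum : (n : ℕ) → (Fin (suc n) → Fin (suc n) → Poly) → {m : ℕ} → ℤ → (Fin m → Fin (suc n)) → Poly
    cofactorSum = _

    private
      match : ∀ n M {m} s f (p q r : Poly) → p ≡ q +ₚ (r +ₚ cofactorSum n M {m} s f) → ⊤
      match _ _ _ _ _ _ _ _ = tt

      match-det : ∀ n M p → p ≡ det (suc n) M → ⊤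
      match-det n M p e with -1ℤ | (λ (j : Fin n) → suc j)
      match-det (suc n) M p e | s | f with f zero
      ... | c₀ with det (suc n) (λ r c → M (suc r) (suc c))
      ... | d₀ with det (suc n) (λ r c → M (suc r) (punchIn c₀ c))
      ... | d₁ with - s | (λ (k : Fin n) → f (suc k))
      ... | s′ | g with suc n
      ... | n+1 = match n+1 M s′ g p (1ℤ ·ₚ (M zero zero *ₚ d₀)) (s ·ₚ (M zero c₀ *ₚ d₁)) e
      match-det zero M p e | s | f = tt

  constantTerms : ∀ {n} → (Fin n → Fin n → Poly) → Matrix n
  constantTerms M i j = coeff (M i j) 0

  mutual
    coeff₀-det : ∀ n M → coeff (det n M) 0 ≡ detℤ n (constantTerms M)
    coeff₀-det zero    M = refl
    coeff₀-det (suc n) M = trans (coeff₀-cofactorSum n M 1ℤ (λ j → j)) (*-identityˡ _)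

    coeff₀-cofactorSum : ∀ n M {m} s (f : Fin m → Fin (suc n)) →
      coeff (cofactorSum n M s f) 0
        ≡ s * ∑[ k < m ] (sign k * (constantTerms M zero (f k) * detℤ n (minor (constantTerms M) (f k))))
    coeff₀-cofactorSum n M {zero}  s f = sym (*-zeroʳ s)
    coeff₀-cofactorSum n M {suc m} s f = begin
      coeff (s ·ₚ (M zero (f zero) *ₚ det n M′) +ₚ cofactorSum n M (- s) (f ∘ suc)) 0
        ≡⟨ coeff-+ₚ (s ·ₚ (M zero (f zero) *ₚ det n M′)) _ 0 ⟩
      coeff (s ·ₚ (M zero (f zero) *ₚ det n M′)) 0 + coeff (cofactorSum n M (- s) (f ∘ suc)) 0
        ≡⟨ cong₂ _+_ (trans (coeff-·ₚ s (M zero (f zero) *ₚ det n M′) 0)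
                            (cong (s *_) (trans (coeff₀-*ₚ (M zero (f zero)) (det n M′))
                                                (cong (coeff (M zero (f zero)) 0 *_) (coeff₀-det n M′)))))
                     (coeff₀-cofactorSum n M (- s) (f ∘ suc)) ⟩
      s * t zero + (- s) * ∑[ k < m ] (sign k * t (suc k))
        ≡⟨ regroup s (t zero) (∑[ k < m ] (sign k * t (suc k))) ⟩
      s * (1ℤ * t zero + -1ℤ * ∑[ k < m ] (sign k * t (suc k)))
        ≡⟨ cong (λ x → s * (1ℤ * t zero + x)) (trans (*-distribˡ-sum -1ℤ (λ k → sign k * t (suc k)))
                                                    (sum-cong-≗ λ k → negate (sign k) (t (suc k)))) ⟩
      s * ∑[ k < suc m ] (sign k * t k) ∎
      where
      open ≡-Reasoning
      M′ : Fin n → Fin n → Poly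
      M′ r c = M (suc r) (punchIn (f zero) c)
      t : Fin (suc m) → ℤ
      t k = constantTerms M zero (f k) * detℤ n (minor (constantTerms M) (f k))
      regroup : ∀ s x y → s * x + (- s) * y ≡ s * (1ℤ * x + -1ℤ * y)
      regroup = solve-∀
      negate : ∀ x y → -1ℤ * (x * y) ≡ (- x) * y
      negate = solve-∀

  mutual
    det-degree : ∀ n M → (∀ i j → Deg≤ (M i j) 1) → Deg≤ (det n M) n
    det-degree zero    M linear (suc k) _ = refl
    det-degree (suc n) M linear = cofactorSum-degree n M linear 1ℤ (λ j → j) (linear zero)

    cofactorSum-degree : ∀ n M → (∀ i j → Deg≤ (M i j) 1) → ∀ {m e} s (f : Fin m → Fin (suc n)) →
                         (∀ k → Deg≤ (M zero (f k)) e) → Deg≤ (cofactorSum n M s f) (e ℕ.+ n)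
    cofactorSum-degree n M linear {zero}  s f row k _ = refl
    cofactorSum-degree n M linear {suc m} s f row =
      Deg≤-+ₚ (s ·ₚ (x *ₚ d)) (cofactorSum n M (- s) (f ∘ suc))
        (Deg≤-·ₚ s (x *ₚ d) (Deg≤-*ₚ x d (row zero)
                               (det-degree n (minor M (f zero)) (λ r c → linear (suc r) (punchIn (f zero) c)))))
        (cofactorSum-degree n M linear (- s) (f ∘ suc) (row ∘ suc))
      where
      x = M zero (f zero)
      d = det n (minor M (f zero))

  record CharacteristicLike {n} (M : Fin n → Fin n → Poly) : Set where
    field
      entry-linear      : ∀ i j → Deg≤ (M i j) 1
      off-diag-constant : ∀ i j → i ≢ j → Deg≤ (M i j) 0
      diag-monic        : ∀ i → coeff (M i i) 1 ≡ 1ℤ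

  det-monic : ∀ n M → CharacteristicLike M → coeff (det n M) n ≡ 1ℤ
  det-monic zero    M shape = refl
  det-monic (suc n) M shape = begin
    coeff (1ℤ ·ₚ (M zero zero *ₚ det n M′) +ₚ cofactorSum n M -1ℤ suc) (suc n)
      ≡⟨ coeff-+ₚ (1ℤ ·ₚ (M zero zero *ₚ det n M′)) _ (suc n) ⟩
    coeff (1ℤ ·ₚ (M zero zero *ₚ det n M′)) (suc n) + coeff (cofactorSum n M -1ℤ suc) (suc n)
      ≡⟨ cong₂ _+_ (trans (coeff-·ₚ 1ℤ (M zero zero *ₚ det n M′) (suc n)) (*-identityˡ _))
                   (cofactorSum-degree n M entry-linear -1ℤ suc (λ k → off-diag-constant zero (suc k) λ ())
                                     (suc n) (n<1+n n)) ⟩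
    coeff (M zero zero *ₚ det n M′) (1 ℕ.+ n) + 0ℤ
      ≡⟨ cong (_+ 0ℤ) (coeff-*ₚ-top (M zero zero) (det n M′) (entry-linear zero zero)
                                     (det-degree n M′ (λ r c → entry-linear (suc r) (suc c)))) ⟩
    coeff (M zero zero) 1 * coeff (det n M′) n + 0ℤ
      ≡⟨ cong₂ (λ x y → x * y + 0ℤ) (diag-monic zero) (det-monic n M′ shape′) ⟩
    1ℤ ∎
    where
    open ≡-Reasoning
    open CharacteristicLike shape
    M′ : Fin n → Fin n → Poly
    M′ r c = M (suc r) (suc c)
    shape′ : CharacteristicLike M′
    shape′ = record
      { entry-linear      = λ r c → entry-linear (suc r) (suc c)
      ; off-diag-constant = λ r c r≢c → off-diag-constant (suc r) (suc c) (r≢c ∘ suc-injective)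
      ; diag-monic        = λ r → diag-monic (suc r)
      }

  charMatrix-diag : ∀ {n} (G : Graph n) i → charMatrix G i i ≡ (0ℤ ∷ 1ℤ ∷ []) +ₚ (- adjMatrix G i i ∷ [])
  charMatrix-diag G i =
    cong (λ b → (if b then 0ℤ ∷ 1ℤ ∷ [] else []) +ₚ (- adjMatrix G i i ∷ [])) (dec-true (i ≟ i) refl)

  charMatrix-off-diag : ∀ {n} (G : Graph n) {i j} → i ≢ j → charMatrix G i j ≡ - adjMatrix G i j ∷ []
  charMatrix-off-diag G {i} {j} i≢j =
    cong (λ b → (if b then 0ℤ ∷ 1ℤ ∷ [] else []) +ₚ (- adjMatrix G i j ∷ [])) (dec-false (i ≟ j) i≢j)

  charMatrix-characteristicLike : ∀ {n} (G : Graph n) → CharacteristicLike (charMatrix G)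
  charMatrix-characteristicLike G = record
    { entry-linear      = linear
    ; off-diag-constant = λ i j i≢j →
        subst (λ p → Deg≤ p 0) (sym (charMatrix-off-diag G i≢j)) λ { (suc k) _ → refl }
    ; diag-monic        = λ i → cong (λ p → coeff p 1) (charMatrix-diag G i)
    }
    where
    linear : ∀ i j → Deg≤ (charMatrix G i j) 1
    linear i j with does (i ≟ j)
    ... | true  = λ { (suc (suc k)) _ → refl ; (suc zero) (s≤s ()) }
    ... | false = λ { (suc (suc k)) _ → refl ; (suc zero) (s≤s ()) }

  constantTerms-charMatrix : ∀ {n} (G : Graph n) i j → constantTerms (charMatrix G) i j ≡ - adjMatrix G i j
  constantTerms-charMatrix G i j with does (i ≟ j)
  ... | true  = +-identityˡ _
  ... | false = refl

  charPoly-monic : ∀ {n} (G : Graph n) → a G 0 ≡ 1ℤ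
  charPoly-monic {n} G = det-monic n (charMatrix G) (charMatrix-characteristicLike G)

  negAdj : ∀ {n} → Graph n → Matrix n
  negAdj G i j = - adjMatrix G i j

  charPoly-constant : ∀ {n} (G : Graph n) → a G n ≡ detℤ n (negAdj G)
  charPoly-constant {n} G = begin
    coeff (charPoly G) (n ℕ.∸ n)   ≡⟨ cong (coeff (charPoly G)) (n∸n≡0 n) ⟩
    coeff (det n (charMatrix G)) 0  ≡⟨ coeff₀-det n (charMatrix G) ⟩
    detℤ n (constantTerms (charMatrix G)) ≡⟨ detℤ-cong n (constantTerms-charMatrix G) ⟩
    detℤ n (negAdj G) ∎
    where open ≡-Reasoning

open CharacteristicPolynomial

module Acyclicity where

  open import Defs using (Graph; adj; adj-sym; adj-irrefl; Adj; Chain; single; step; IsCycle; Acyclic)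
  open import Data.Nat as ℕ using (zero; suc; _≤_; z≤n; s≤s)
  open import Data.Nat.Properties using (≤-trans; n≤1+n; +-suc; +-identityʳ; <-irrefl)
  open import Data.Fin using (Fin; zero; suc; punchOut; _≟_; toℕ)
  open import Data.Fin.Properties using (punchOut-injective; any?)
  open import Data.Bool as Bool using (true; false)
  open import Data.Bool.Properties using (¬-not)
  open import Data.List using (List; []; _∷_; length; map; take)
  open import Data.List.Properties using (length-map)
  open import Data.List.Relation.Unary.All using (All; []; _∷_)
  open import Data.List.Relation.Unary.All.Properties using (¬Any⇒All¬)
  open import Data.List.Relation.Unary.AllPairs using ([]; _∷_)
  open import Data.List.Relation.Unary.Any using (here; there; index)
  open import Data.List.Membership.Propositional using (_∈_; _∉_)
  open import Data.List.Relation.Unary.Unique.Propositional using (Unique)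
  import Data.List.Relation.Unary.Unique.Propositional.Properties as Unique
  open import Data.Product using (∃; _×_; _,_)
  open import Data.Sum using (_⊎_; inj₁; inj₂)
  open import Data.Unit using (⊤; tt)
  open import Function using (_∘_)
  open import Relation.Nullary using (yes; no; contradiction)
  open import Relation.Nullary.Decidable using (_×-dec_; ¬?; decidable-stable)
  open import Relation.Binary.PropositionalEquality

  -- As for `det`, the local helper `lastOr` of `IsCycle` is recovered by
  -- unification.
  mutual
    lastOr : ∀ {n} (G : Graph n) (v : Fin n) (vs : List (Fin n)) → Fin n → List (Fin n) → Fin n
    lastOr = _

    private
      match : ∀ {n} (G : Graph n) v w x xs → Adj G (lastOr G v w x xs) v → ⊤
      match _ _ _ _ _ _ = tt

      match-cycle : ∀ {n} (G : Graph n) v y ys → IsCycle G (v ∷ y ∷ ys) → ⊤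
      match-cycle G v y ys (_ , _ , _ , closing) with y ∷ ys
      ... | w = match G v w y ys closing

  last : ∀ {A : Set} → A → List A → A
  last x []       = x
  last x (y ∷ ys) = last y ys

  lastOr≡last : ∀ {n} (G : Graph n) v vs x ys → lastOr G v vs x ys ≡ last x ys
  lastOr≡last G v vs x []       = refl
  lastOr≡last G v vs x (y ∷ ys) = lastOr≡last G v vs y ys

  isCycle : ∀ {n} (G : Graph n) v vs → 3 ≤ length (v ∷ vs) → Unique (v ∷ vs) → Chain G (v ∷ vs) →
            Adj G (last v vs) v → IsCycle G (v ∷ vs)
  isCycle G v vs long unique chain closing =
    long , unique , chain , subst (λ x → Adj G x v) (sym (lastOr≡last G v vs v vs)) closing

  isCycle-closing : ∀ {n} (G : Graph n) v vs → IsCycle G (v ∷ vs) → Adj G (last v vs) v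
  isCycle-closing G v vs (_ , _ , _ , closing) = subst (λ x → Adj G x v) (lastOr≡last G v vs v vs) closing

  module _ {n} (G : Graph n) where

    Adj-sym : ∀ {u v} → Adj G u v → Adj G v u
    Adj-sym {u} {v} uv = trans (adj-sym G v u) uv

    Adj⇒≢ : ∀ {u v} → Adj G u v → u ≢ v
    Adj⇒≢ {u} uu refl with trans (sym uu) (adj-irrefl G u)
    ... | ()

    Isolated : Fin n → Set
    Isolated v = ∀ w → adj G v w ≡ false

    IsLeaf : Fin n → Fin n → Set
    IsLeaf v u = Adj G v u × (∀ w → Adj G v w → w ≡ u)

    LowDegree : Fin n → Set
    LowDegree v = Isolated v ⊎ ∃ (IsLeaf v)

  unique-length≤ : ∀ {n} (xs : List (Fin n)) → Unique xs → length xs ≤ n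
  unique-length≤          []       _              = z≤n
  unique-length≤ {suc n} (x ∷ ys) (x∉ys ∷ unique) =
    s≤s (subst (_≤ n) (length-punchOutAll ys x∉ys)
               (unique-length≤ (punchOutAll ys x∉ys) (punchOutAll-unique ys x∉ys unique)))
    where
    punchOutAll : ∀ zs → All (x ≢_) zs → List (Fin n)
    punchOutAll []       []            = []
    punchOutAll (z ∷ zs) (x≢z ∷ x∉zs) = punchOut x≢z ∷ punchOutAll zs x∉zs

    length-punchOutAll : ∀ zs x∉zs → length (punchOutAll zs x∉zs) ≡ length zs
    length-punchOutAll []       []            = refl
    length-punchOutAll (z ∷ zs) (x≢z ∷ x∉zs) = cong suc (length-punchOutAll zs x∉zs)

    punchOut-∉ : ∀ {z} (x≢z : x ≢ z) zs x∉zs → All (z ≢_) zs → All (punchOut x≢z ≢_) (punchOutAll zs x∉zs)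
    punchOut-∉ x≢z []       []            []            = []
    punchOut-∉ x≢z (w ∷ ws) (x≢w ∷ x∉ws) (z≢w ∷ z∉ws) =
      (z≢w ∘ punchOut-injective x≢z x≢w) ∷ punchOut-∉ x≢z ws x∉ws z∉ws

    punchOutAll-unique : ∀ zs x∉zs → Unique zs → Unique (punchOutAll zs x∉zs)
    punchOutAll-unique []       []            []               = []
    punchOutAll-unique (z ∷ zs) (x≢z ∷ x∉zs) (z∉zs ∷ unique) =
      punchOut-∉ x≢z zs x∉zs z∉zs ∷ punchOutAll-unique zs x∉zs unique

  Chain-take : ∀ {n} {G : Graph n} k z zs → Chain G (z ∷ zs) → Chain G (z ∷ take k zs)
  Chain-take zero    z zs       chain           = single
  Chain-take (suc k) z []       chain           = chain
  Chain-take (suc k) z (y ∷ ys) (step zy chain) = step zy (Chain-take k y ys chain)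

  last-take-index : ∀ {A : Set} {x : A} z ys (x∈ys : x ∈ ys) → last z (take (suc (toℕ (index x∈ys))) ys) ≡ x
  last-take-index z (y ∷ ys) (here refl) = refl
  last-take-index z (y ∷ ys) (there x∈ys) = last-take-index y ys x∈ys

  module _ {n} (G : Graph n) (acyclic : Acyclic G) where

    -- Otherwise w, p, …, x would be a cycle.
    acyclic-no-chord : ∀ {w p x} rest → Unique (w ∷ p ∷ rest) → Chain G (w ∷ p ∷ rest) → Adj G w x → x ∉ rest
    acyclic-no-chord {w} {p} rest unique chain wx x∈rest = acyclic _
      (isCycle G w (p ∷ prefix) (long rest x∈rest) (Unique.take⁺ (3 ℕ.+ toℕ (index x∈rest)) unique)
               (Chain-take (2 ℕ.+ toℕ (index x∈rest)) w (p ∷ rest) chain)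
               (subst (λ y → Adj G y w) (sym (last-take-index p rest x∈rest)) (Adj-sym G wx)))
      where
      prefix = take (suc (toℕ (index x∈rest))) rest
      long : ∀ {x} ys (x∈ys : x ∈ ys) → 3 ≤ length (w ∷ p ∷ take (suc (toℕ (index x∈ys))) ys)
      long (y ∷ ys) _ = s≤s (s≤s (s≤s z≤n))

    extend-or-lowDegree : ∀ w rest → Unique (w ∷ rest) → Chain G (w ∷ rest) →
                          LowDegree G w ⊎ ∃ λ x → Unique (x ∷ w ∷ rest) × Chain G (x ∷ w ∷ rest)
    extend-or-lowDegree w [] unique chain with any? (λ x → adj G w x Bool.≟ true)
    ... | no  no-neighbour = inj₁ (inj₁ λ x → ¬-not (no-neighbour ∘ (x ,_)))
    ... | yes (x , wx)     = inj₂ (x , ((Adj⇒≢ G wx ∘ sym) ∷ []) ∷ [] ∷ [] , step (Adj-sym G wx) single)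
    extend-or-lowDegree w (p ∷ rest) unique chain@(step wp _)
      with any? (λ x → (adj G w x Bool.≟ true) ×-dec ¬? (x ≟ p))
    ... | no  no-other = inj₁ (inj₂ (p , wp , λ x wx → decidable-stable (x ≟ p) (no-other ∘ (x ,_) ∘ (wx ,_))))
    ... | yes (x , wx , x≢p) =
      inj₂ (x , ((Adj⇒≢ G wx ∘ sym) ∷ x≢p ∷ ¬Any⇒All¬ rest (acyclic-no-chord rest unique chain wx)) ∷ unique
              , step (Adj-sym G wx) chain)

    -- Grow a path until its head has degree at most one; a path cannot have
    -- more than n vertices, so `fuel` extensions suffice.
    lowDegree-from : ∀ fuel w rest → n ≤ length (w ∷ rest) ℕ.+ fuel → Unique (w ∷ rest) → Chain G (w ∷ rest) →
                     ∃ (LowDegree G)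
    lowDegree-from fuel w rest bound unique chain with extend-or-lowDegree w rest unique chain
    ... | inj₁ low = w , low
    lowDegree-from zero w rest bound unique chain | inj₂ (x , unique′ , _) =
      contradiction (≤-trans (unique-length≤ (x ∷ w ∷ rest) unique′) (subst (n ≤_) (+-identityʳ _) bound))
                    (<-irrefl refl)
    lowDegree-from (suc fuel) w rest bound unique chain | inj₂ (x , unique′ , chain′) =
      lowDegree-from fuel x (w ∷ rest) (subst (n ≤_) (+-suc _ fuel) bound) unique′ chain′

    acyclic⇒lowDegree : Fin n → ∃ (LowDegree G)
    acyclic⇒lowDegree v = lowDegree-from n v [] (n≤1+n n) ([] ∷ []) single

  induced : ∀ {m k} → Graph m → (Fin k → Fin m) → Graph k
  induced G σ = record
    { adj        = λ i j → adj G (σ i) (σ j)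
    ; adj-sym    = λ i j → adj-sym G (σ i) (σ j)
    ; adj-irrefl = λ i → adj-irrefl G (σ i)
    }

  module _ {m k} (G : Graph m) (σ : Fin k → Fin m) where

    Chain-map : ∀ vs → Chain (induced G σ) vs → Chain G (map σ vs)
    Chain-map (v ∷ [])     single          = single
    Chain-map (v ∷ w ∷ vs) (step vw chain) = step vw (Chain-map (w ∷ vs) chain)

    last-map : ∀ v vs → last (σ v) (map σ vs) ≡ σ (last v vs)
    last-map v []       = refl
    last-map v (w ∷ vs) = last-map w vs

    induced-acyclic : (∀ {i j} → σ i ≡ σ j → i ≡ j) → Acyclic G → Acyclic (induced G σ)
    induced-acyclic σ-injective acyclic (v ∷ vs) cycle@(long , unique , chain , _) = acyclic _
      (isCycle G (σ v) (map σ vs) (subst (3 ≤_) (sym (length-map σ (v ∷ vs))) long)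
               (Unique.map⁺ σ-injective unique) (Chain-map (v ∷ vs) chain)
               (subst (λ x → Adj G x (σ v)) (sym (last-map v vs)) (isCycle-closing (induced G σ) v vs cycle)))

open Acyclicity

module Forests where

  open import Defs using (Graph; adj; adj-sym; Adj; Acyclic)
  open import Data.Nat as ℕ using (ℕ; zero; suc)
  open import Data.Nat.Properties using (+-suc)
  open import Data.Integer using (ℤ; 0ℤ; 1ℤ; -1ℤ; _*_; -_; _^_)
  open import Data.Integer.Properties using (-1*i≡-i; *-assoc; *-identityˡ)
  open import Data.Fin using (Fin; zero; suc; punchOut)
  open import Data.Fin.Properties using (punchIn-punchOut; suc-injective)
  open import Data.Bool using (false; if_then_else_)
  open import Data.Bool.Properties using (¬-not)
  open import Data.Product using (∃; _×_; _,_; proj₁; proj₂)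
  open import Data.Sum using (_⊎_; inj₁; inj₂)
  open import Data.Empty using (⊥-elim)
  open import Function using (_∘_)
  open import Relation.Binary.PropositionalEquality

  negAdj-false : ∀ {n} (G : Graph n) {i j} → adj G i j ≡ false → negAdj G i j ≡ 0ℤ
  negAdj-false G e = cong (λ b → - (if b then 1ℤ else 0ℤ)) e

  negAdj-true : ∀ {n} (G : Graph n) {i j} → Adj G i j → negAdj G i j ≡ -1ℤ
  negAdj-true G e = cong (λ b → - (if b then 1ℤ else 0ℤ)) e

  ForestDet : ℕ → ℤ → Set
  ForestDet n d = d ≡ 0ℤ ⊎ ∃ λ m → n ≡ m ℕ.+ m × d ≡ -1ℤ ^ m

  detℤ-isolated : ∀ n (G : Graph (suc n)) v → Isolated G v → detℤ (suc n) (negAdj G) ≡ 0ℤ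
  detℤ-isolated n G v isolated = trans (sym (detℤ-toFront n (negAdj G) v))
    (detℤ-zero-row n (negAdj (induced G (toFront v))) (λ j → negAdj-false G (isolated (toFront v j))))

  -1*[-1*i]≡i : ∀ i → -1ℤ * (-1ℤ * i) ≡ i
  -1*[-1*i]≡i i = trans (sym (*-assoc -1ℤ -1ℤ i)) (*-identityˡ i)

  ForestDet-step : ∀ {n d} → ForestDet n d → ForestDet (suc (suc n)) (- d)
  ForestDet-step (inj₁ d≡0)           = inj₁ (cong -_ d≡0)
  ForestDet-step (inj₂ (m , n≡ , d≡)) =
    inj₂ (suc m , cong suc (trans (cong suc n≡) (sym (+-suc m m))) , trans (cong -_ d≡) (sym (-1*i≡-i _)))

  -- Relabel so that the leaf comes first and its neighbour second; the
  -- cofactor expansion along the leaf's row and column then deletes both.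
  detℤ-leaf-removal : ∀ n (G : Graph (suc (suc n))) v u → IsLeaf G v u →
    ∃ λ (σ : Fin n → Fin (suc (suc n))) → (∀ {i j} → σ i ≡ σ j → i ≡ j)
                                        × detℤ (suc (suc n)) (negAdj G) ≡ - detℤ n (negAdj (induced G σ))
  detℤ-leaf-removal n G v u leaf = σ , (suc-injective ∘ suc-injective ∘ ρ-injective) , (begin
    detℤ (suc (suc n)) (negAdj G)
      ≡⟨ sym (detℤ-toFront (suc n) (negAdj G) u) ⟩
    detℤ (suc (suc n)) (negAdj (induced G (toFront u)))
      ≡⟨ sym (detℤ-toFront (suc n) (negAdj (induced G (toFront u))) (suc v′)) ⟩
    detℤ (suc (suc n)) (negAdj (induced G ρ))
      ≡⟨ detℤ-leaf n (negAdj (induced G ρ)) first-row first-column ⟩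
    - (negAdj G (ρ zero) u * (negAdj G u (ρ zero) * detℤ n (negAdj (induced G σ))))
      ≡⟨ cong₂ (λ x y → - (x * (y * detℤ n (negAdj (induced G σ)))))
               (negAdj-true G vu) (negAdj-true G (Adj-sym G vu)) ⟩
    - (-1ℤ * (-1ℤ * detℤ n (negAdj (induced G σ))))
      ≡⟨ cong -_ (-1*[-1*i]≡i (detℤ n (negAdj (induced G σ)))) ⟩
    - detℤ n (negAdj (induced G σ)) ∎)
    where
    open ≡-Reasoning
    u≢v : u ≢ v
    u≢v = Adj⇒≢ G (Adj-sym G (proj₁ leaf))
    v′ = punchOut u≢v
    ρ : Fin (suc (suc n)) → Fin (suc (suc n))
    ρ i = toFront u (toFront (suc v′) i)
    ρ-injective : ∀ {i j} → ρ i ≡ ρ j → i ≡ j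
    ρ-injective = toFront-injective (suc v′) ∘ toFront-injective u
    σ : Fin n → Fin (suc (suc n))
    σ r = ρ (suc (suc r))
    leaf′ : IsLeaf G (ρ zero) u
    leaf′ = subst (λ x → IsLeaf G x u) (sym (punchIn-punchOut u≢v)) leaf
    vu = proj₁ leaf′
    not-neighbour : ∀ j → j ≢ suc zero → adj G (ρ zero) (ρ j) ≡ false
    not-neighbour j j≢1 = ¬-not (j≢1 ∘ ρ-injective ∘ proj₂ leaf′ (ρ j))
    first-row : ∀ j → j ≢ suc zero → negAdj G (ρ zero) (ρ j) ≡ 0ℤ
    first-row j j≢1 = negAdj-false G (not-neighbour j j≢1)
    first-column : ∀ r → negAdj G (σ r) (ρ zero) ≡ 0ℤ
    first-column r = negAdj-false G (trans (adj-sym G (σ r) (ρ zero)) (not-neighbour (suc (suc r)) λ ()))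

  mutual
    forest-det : ∀ n (G : Graph n) → Acyclic G → ForestDet n (detℤ n (negAdj G))
    forest-det zero    G acyclic = inj₂ (0 , refl , refl)
    forest-det (suc n) G acyclic with acyclic⇒lowDegree G acyclic zero
    ... | v , inj₁ isolated   = inj₁ (detℤ-isolated n G v isolated)
    ... | v , inj₂ (u , leaf) = forest-det-leaf n G acyclic v u leaf

    forest-det-leaf : ∀ n (G : Graph (suc n)) → Acyclic G → ∀ v u → IsLeaf G v u →
                      ForestDet (suc n) (detℤ (suc n) (negAdj G))
    forest-det-leaf zero    G acyclic zero zero (vv , _) = ⊥-elim (Adj⇒≢ G vv refl)
    forest-det-leaf (suc n) G acyclic v u leaf =
      let σ , σ-injective , det≡ = detℤ-leaf-removal n G v u leaf
      in subst (ForestDet (suc (suc n))) (sym det≡)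
           (ForestDet-step (forest-det n (induced G σ) (induced-acyclic G σ σ-injective acyclic)))

open Forests

open import Data.Nat as ℕ using (ℕ; zero; suc; _%_; z≤n)
open import Data.Nat.Divisibility using (_∣_; divides; ∣m∣n⇒∣m+n)
open import Data.Nat.DivMod using ([m+kn]%n≡m%n)
open import Data.Nat.Tactic.RingSolver using (solve-∀)
open import Data.Integer using (1ℤ; -1ℤ; -_; _^_)
open import Data.Integer.Properties using (neg-involutive)
open import Data.Product using (_×_; _,_)
open import Data.Sum using (inj₁; inj₂)
open import Relation.Binary.PropositionalEquality

palindromic⇒det≡1 : ∀ {n} (G : Graph n) → Palindromic G → detℤ n (negAdj G) ≡ 1ℤ
palindromic⇒det≡1 G pal = trans (sym (charPoly-constant G)) (trans (sym (pal 0 z≤n)) (charPoly-monic G))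

antipalindromic⇒det≡-1 : ∀ {n} (G : Graph n) → Antipalindromic G → detℤ n (negAdj G) ≡ -1ℤ
antipalindromic⇒det≡-1 G anti = trans (sym (charPoly-constant G))
  (trans (sym (neg-involutive _)) (cong -_ (trans (sym (anti 0 z≤n)) (charPoly-monic G))))

[2+m]+[2+m]≡m+m+1*4 : ∀ m → suc (suc m) ℕ.+ suc (suc m) ≡ (m ℕ.+ m) ℕ.+ 1 ℕ.* 4
[2+m]+[2+m]≡m+m+1*4 = solve-∀

-1^m≡1⇒4∣m+m : ∀ m → -1ℤ ^ m ≡ 1ℤ → 4 ∣ m ℕ.+ m
-1^m≡1⇒4∣m+m zero          _ = divides 0 refl
-1^m≡1⇒4∣m+m (suc zero)    ()
-1^m≡1⇒4∣m+m (suc (suc m)) e = subst (4 ∣_) (sym ([2+m]+[2+m]≡m+m+1*4 m))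
  (∣m∣n⇒∣m+n (-1^m≡1⇒4∣m+m m (trans (sym (-1*[-1*i]≡i (-1ℤ ^ m))) e)) (divides 1 refl))

-1^m≡-1⇒[m+m]%4≡2 : ∀ m → -1ℤ ^ m ≡ -1ℤ → (m ℕ.+ m) % 4 ≡ 2
-1^m≡-1⇒[m+m]%4≡2 zero          ()
-1^m≡-1⇒[m+m]%4≡2 (suc zero)    _ = refl
-1^m≡-1⇒[m+m]%4≡2 (suc (suc m)) e = begin
  (suc (suc m) ℕ.+ suc (suc m)) % 4 ≡⟨ cong (_% 4) ([2+m]+[2+m]≡m+m+1*4 m) ⟩
  ((m ℕ.+ m) ℕ.+ 1 ℕ.* 4) % 4       ≡⟨ [m+kn]%n≡m%n (m ℕ.+ m) 1 4 ⟩
  (m ℕ.+ m) % 4                     ≡⟨ -1^m≡-1⇒[m+m]%4≡2 m (trans (sym (-1*[-1*i]≡i (-1ℤ ^ m))) e) ⟩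
  2                                 ∎
  where open ≡-Reasoning

ForestDet[1]⇒4∣n : ∀ {n} → ForestDet n 1ℤ → 4 ∣ n
ForestDet[1]⇒4∣n (inj₁ ())
ForestDet[1]⇒4∣n (inj₂ (m , refl , 1≡)) = -1^m≡1⇒4∣m+m m (sym 1≡)

ForestDet[-1]⇒n%4≡2 : ∀ {n} → ForestDet n -1ℤ → n % 4 ≡ 2
ForestDet[-1]⇒n%4≡2 (inj₁ ())
ForestDet[-1]⇒n%4≡2 (inj₂ (m , refl , -1≡)) = -1^m≡-1⇒[m+m]%4≡2 m (sym -1≡)

corollary3 : ∀ (n : ℕ) (G : Graph n) → IsTree G →
    (Palindromic G → 4 ∣ n) × (Antipalindromic G → n % 4 ≡ 2)
corollary3 n G (_ , acyclic) =
  (λ pal  → ForestDet[1]⇒4∣n (subst (ForestDet n) (palindromic⇒det≡1 G pal) (forest-det n G acyclic))) ,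
  (λ anti → ForestDet[-1]⇒n%4≡2 (subst (ForestDet n) (antipalindromic⇒det≡-1 G anti) (forest-det n G acyclic)))
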